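{- Let $i\ge 1$, $k\ge 1$, $l\ge 1$ be integers. Then $F(R_{i,0,k,l}) < F(R_{0,0,i+k,l})$.
   Context: All graphs are finite and simple. The F-index of a graph $G$ is $F(G)=\sum_{v\in V(G)} d_G(v)^3$. For integers $i,j\ge 0$ and $k,l\ge 1$, $R_{i,j,k,l}$ is the graph obtained from a triangle $xyz$ by attaching $i$ new leaves to $x$, $j$ new leaves to $y$ and $k$ new pendant vertices to $z$, and then attaching $l$ new leaves to one of the $k$ pendant vertices adjacent to $z$ (attaching a leaf to a vertex means adding a new vertex adjacent only to it). It has $i+j+k+l+3$ vertices. -}

module Defs where

open import Data.Nat using (ℕ; zero; suc; _+_; _*_; _^_; _<ᵇ_; _≡ᵇ_)
open import Data.Bool using (Bool; true; false; _∧_; _∨_; not)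
open import Data.Fin using (Fin; toℕ)
open import Data.List using (List; map; filter; length)
open import Data.Nat.ListAction using (sum)
open import Data.Bool.Properties using (∨-comm)
open import Relation.Binary.PropositionalEquality using (refl; cong; cong₂)
open import Data.List using () renaming (allFin to allFinL)
open import Data.Fin using () 
open import Relation.Binary.PropositionalEquality using (_≡_)
open import Data.Product using (_×_)

record Graph (n : ℕ) : Set where
  field
    adj   : Fin n → Fin n → Bool
    sym   : ∀ u v → adj u v ≡ adj v u
    irrefl : ∀ v → adj v v ≡ false
open Graph public

vertices : (n : ℕ) → List (Fin n)
vertices n = allFinL n

degree : ∀ {n} → Graph n → Fin n → ℕ
degree {n} G v = length (filter (λ u → Data.Bool.T? (adj G v u)) (vertices n))
  where import Data.Bool

Findex : ∀ {n} → Graph n → ℕ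
Findex {n} G = sum (map (λ v → degree G v ^ 3) (vertices n))

-- Labels: 0 = x, 1 = y, 2 = z;
--   3 .. 3+i-1              : the i leaves attached to x;
--   3+i .. 3+i+j-1          : the j leaves attached to y;
--   3+i+j .. 3+i+j+k-1      : the k pendant vertices attached to z,
--                             w = 3+i+j being the one that gets the extra leaves;
--   3+i+j+k .. 3+i+j+k+l-1  : the l leaves attached to w.
-- inR a b c u : a ≤ u < b  (as a Bool)
inR : ℕ → ℕ → ℕ → Bool
inR a b u = not (u <ᵇ a) ∧ (u <ᵇ b)

-- directed "u is the designated parent of leaf/pendant v", or triangle edge
edgeR : ℕ → ℕ → ℕ → ℕ → ℕ → ℕ → Bool
edgeR i j k l u v =
     ((u ≡ᵇ 0) ∧ (v ≡ᵇ 1))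
  ∨ ((u ≡ᵇ 1) ∧ (v ≡ᵇ 2))
  ∨ ((u ≡ᵇ 0) ∧ (v ≡ᵇ 2))
  ∨ ((u ≡ᵇ 0) ∧ inR 3 (3 + i) v)
  ∨ ((u ≡ᵇ 1) ∧ inR (3 + i) (3 + i + j) v)
  ∨ ((u ≡ᵇ 2) ∧ inR (3 + i + j) (3 + i + j + k) v)
  ∨ ((u ≡ᵇ (3 + i + j)) ∧ inR (3 + i + j + k) (3 + i + j + k + l) v)

adjR : (i j k l : ℕ) → Fin (i + j + k + l + 3) → Fin (i + j + k + l + 3) → Bool
adjR i j k l u v =
  not (toℕ u ≡ᵇ toℕ v) ∧ (edgeR i j k l (toℕ u) (toℕ v) ∨ edgeR i j k l (toℕ v) (toℕ u))

≡ᵇ-refl : ∀ m → (m ≡ᵇ m) ≡ true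
≡ᵇ-refl zero = refl
≡ᵇ-refl (suc m) = ≡ᵇ-refl m

≡ᵇ-sym : ∀ m n → (m ≡ᵇ n) ≡ (n ≡ᵇ m)
≡ᵇ-sym zero zero = refl
≡ᵇ-sym zero (suc n) = refl
≡ᵇ-sym (suc m) zero = refl
≡ᵇ-sym (suc m) (suc n) = ≡ᵇ-sym m n

-- The graph R_{i,j,k,l} (the guard  not (u ≡ᵇ v)  is vacuous: edgeR never
-- relates a label to itself; it only makes irreflexivity immediate).
R : (i j k l : ℕ) → Graph (i + j + k + l + 3)
R i j k l = record
  { adj = adjR i j k l
  ; sym = λ u v → cong₂ _∧_ (cong not (≡ᵇ-sym (toℕ u) (toℕ v)))
                    (∨-comm (edgeR i j k l (toℕ u) (toℕ v)) (edgeR i j k l (toℕ v) (toℕ u)))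
  ; irrefl = λ v → cong (λ b → not b ∧ (edgeR i j k l (toℕ v) (toℕ v) ∨ edgeR i j k l (toℕ v) (toℕ v))) (≡ᵇ-refl (toℕ v))
  }

-- R_{i,j,k,l} has eight kinds of vertices: x, y, z, the leaves of x, of y and of w, the pendant w,
-- and the other pendants of z.  Adjacency depends only on the kind, so the degrees are 2 + i,
-- 2 + j, 2 + k, 1 + l and 1, and
--   F(R_{i,j,k,l}) = (2 + i)³ + (2 + j)³ + (2 + k)³ + (1 + l)³ + i + j + (k - 1) + l.
-- Passing from R_{i,0,k,l} to R_{0,0,i+k,l} keeps the linear part and the cube of w, and trades
-- the triangle cubes (2 + i)³ + 2³ + (2 + k)³ for 2³ + 2³ + (2 + i + k)³, which is larger.
module Submission where

open import Defs hiding (sym)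
open import Data.Nat using (ℕ; zero; suc; _+_; _*_; _^_; _≤_; _<_; _≥_; _<ᵇ_; _≡ᵇ_; z≤n; s≤s; z<s; s<s)
open import Data.Nat.Properties
open import Data.Nat.ListAction using (sum)
open import Data.Nat.ListAction.Properties using (sum-++)
open import Data.Nat.Tactic.RingSolver using (solve)
open import Data.Nat.Solver using (module +-*-Solver)
open import Data.Bool using (Bool; true; false; _∧_; _∨_; not; T; T?)
open import Data.Bool.Properties using (∧-zeroʳ)
open import Data.Empty using (⊥-elim)
open import Data.Fin using (Fin; toℕ)
open import Data.List using (List; []; _∷_; _++_; map; filter; length; tabulate; applyUpTo)
open import Data.List.Properties using (map-cong; map-∘; map-tabulate; map-applyUpTo)
open import Data.Unit using (tt)
open import Function using (_∘_; id)
open import Function.Nary.NonDependent using (congₙ)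
open import Relation.Binary.PropositionalEquality
open import Relation.Nullary using (¬_)

private
  variable
    A : Set
    a b m n u : ℕ

𝟙 : Bool → ℕ
𝟙 true  = 1
𝟙 false = 0

length-filter-T? : (p : A → Bool) (xs : List A) →
                   length (filter (T? ∘ p) xs) ≡ sum (map (𝟙 ∘ p) xs)
length-filter-T? p []       = refl
length-filter-T? p (x ∷ xs) with p x
... | true  = cong suc (length-filter-T? p xs)
... | false = length-filter-T? p xs

tabulate-toℕ : ∀ n (f : ℕ → A) → tabulate {n = n} (f ∘ toℕ) ≡ applyUpTo f n
tabulate-toℕ zero    f = refl
tabulate-toℕ (suc n) f = cong (f 0 ∷_) (tabulate-toℕ n (f ∘ suc))

applyUpTo-++ : ∀ (f : ℕ → A) m n →
               applyUpTo f (m + n) ≡ applyUpTo f m ++ applyUpTo (λ x → f (m + x)) n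
applyUpTo-++ f zero    n = refl
applyUpTo-++ f (suc m) n = cong (f 0 ∷_) (applyUpTo-++ (f ∘ suc) m n)

sum-applyUpTo-++ : ∀ (f : ℕ → ℕ) m n →
  sum (applyUpTo f (m + n)) ≡ sum (applyUpTo f m) + sum (applyUpTo (λ x → f (m + x)) n)
sum-applyUpTo-++ f m n = trans (cong sum (applyUpTo-++ f m n)) (sum-++ (applyUpTo f m) _)

sum-applyUpTo-const : ∀ (f : ℕ → ℕ) {c} m → (∀ x → x < m → f x ≡ c) →
                      sum (applyUpTo f m) ≡ m * c
sum-applyUpTo-const f zero    f≡c = refl
sum-applyUpTo-const f (suc m) f≡c =
  cong₂ _+_ (f≡c 0 z<s) (sum-applyUpTo-const (f ∘ suc) m (λ x x<m → f≡c (suc x) (s<s x<m)))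

<ᵇ-true : m < n → (m <ᵇ n) ≡ true
<ᵇ-true (s≤s z≤n)       = refl
<ᵇ-true (s≤s (s≤s m<n)) = <ᵇ-true (s≤s m<n)

<ᵇ-false : n ≤ m → (m <ᵇ n) ≡ false
<ᵇ-false z≤n       = refl
<ᵇ-false (s≤s n≤m) = <ᵇ-false n≤m

≡ᵇ-false : ¬ m ≡ n → (m ≡ᵇ n) ≡ false
≡ᵇ-false {zero}  {zero}  m≢n = ⊥-elim (m≢n refl)
≡ᵇ-false {zero}  {suc n} m≢n = refl
≡ᵇ-false {suc m} {zero}  m≢n = refl
≡ᵇ-false {suc m} {suc n} m≢n = ≡ᵇ-false (m≢n ∘ cong suc)

inR-true : ∀ a b → a ≤ u → u < b → inR a b u ≡ true
inR-true a b a≤u u<b = cong₂ (λ p q → not p ∧ q) (<ᵇ-false a≤u) (<ᵇ-true u<b)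

inR-below : ∀ b → u < a → inR a b u ≡ false
inR-below {u} b u<a = cong (λ p → not p ∧ (u <ᵇ b)) (<ᵇ-true u<a)

inR-above : ∀ a → b ≤ u → inR a b u ≡ false
inR-above {u = u} a b≤u = trans (cong (not (u <ᵇ a) ∧_) (<ᵇ-false b≤u)) (∧-zeroʳ _)

guard-redundant : (e : ℕ → ℕ → Bool) → (∀ u → e u u ≡ false) →
          ∀ u v → not (u ≡ᵇ v) ∧ (e u v ∨ e v u) ≡ e u v ∨ e v u
guard-redundant e irrefl u v with u ≡ᵇ v in u≡ᵇv
... | false = refl
... | true  with refl ← ≡ᵇ⇒≡ u v (subst T (sym u≡ᵇv) tt) =
  sym (cong₂ _∨_ (irrefl u) (irrefl u))

Findex-by-types : ∀ {n} {S : Set} (G : Graph n) (σ : Fin n → S) (a : S → S → Bool) →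
  (∀ u v → adj G u v ≡ a (σ u) (σ v)) →
  let types = map σ (vertices n) in
  Findex G ≡ sum (map (λ s → sum (map (𝟙 ∘ a s) types) ^ 3) types)
Findex-by-types {n} {S} G σ a adj≡a = begin
  sum (map (λ v → degree G v ^ 3) (vertices n))
    ≡⟨ cong sum (map-cong (λ v → cong (_^ 3) (degree≡ v)) (vertices n)) ⟩
  sum (map (λ v → D (σ v) ^ 3) (vertices n))
    ≡⟨ cong sum (map-∘ (vertices n)) ⟩
  sum (map (λ s → D s ^ 3) (map σ (vertices n))) ∎
  where
  open ≡-Reasoning
  D : S → ℕ
  D s = sum (map (𝟙 ∘ a s) (map σ (vertices n)))
  degree≡ : ∀ v → degree G v ≡ D (σ v)
  degree≡ v = begin
    length (filter (T? ∘ adj G v) (vertices n))    ≡⟨ length-filter-T? (adj G v) (vertices n) ⟩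
    sum (map (𝟙 ∘ adj G v) (vertices n))           ≡⟨ cong sum (map-cong (cong 𝟙 ∘ adj≡a v) (vertices n)) ⟩
    sum (map (𝟙 ∘ a (σ v) ∘ σ) (vertices n))       ≡⟨ cong sum (map-∘ (vertices n)) ⟩
    D (σ v)                                         ∎

-- The eight Boolean tests that edgeR performs on each endpoint, in the order it performs them.
record Signature : Set where
  field
    isX isY isZ inLeavesX inLeavesY inPendants isW inLeavesW : Bool
open Signature

edgeˢ : Signature → Signature → Bool
edgeˢ s t =
     (isX s ∧ isY t)
  ∨ (isY s ∧ isZ t)
  ∨ (isX s ∧ isZ t)
  ∨ (isX s ∧ inLeavesX t)
  ∨ (isY s ∧ inLeavesY t)
  ∨ (isZ s ∧ inPendants t)
  ∨ (isW s ∧ inLeavesW t)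

adjacentˢ : Signature → Signature → Bool
adjacentˢ s t = edgeˢ s t ∨ edgeˢ t s

signature : (i j k l : ℕ) → ℕ → Signature
signature i j k l u = record
  { isX        = u ≡ᵇ 0
  ; isY        = u ≡ᵇ 1
  ; isZ        = u ≡ᵇ 2
  ; inLeavesX  = inR 3 (3 + i) u
  ; inLeavesY  = inR (3 + i) (3 + i + j) u
  ; inPendants = inR (3 + i + j) (3 + i + j + k) u
  ; isW        = u ≡ᵇ (3 + i + j)
  ; inLeavesW  = inR (3 + i + j + k) (3 + i + j + k + l) u
  }

edgeR-irrefl : ∀ i j k l u → edgeR i j (suc k) l u u ≡ false
edgeR-irrefl i j k l 0 = refl
edgeR-irrefl i j k l 1 = refl
edgeR-irrefl i j k l 2 = refl
edgeR-irrefl i j k l (suc (suc (suc x))) with x ≡ᵇ i + j in x≡ᵇw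
... | false = refl
... | true  = inR-below (3 + i + j + suc k + l) (s≤s (s≤s (s≤s (begin-strict
  x                 ≡⟨ ≡ᵇ⇒≡ x (i + j) (subst T (sym x≡ᵇw) tt) ⟩
  i + j             <⟨ m<m+n (i + j) z<s ⟩
  i + j + suc k     ∎))))
  where open ≤-Reasoning

adjR≡adjacentˢ : ∀ i j k l u v →
  adjR i j (suc k) l u v ≡ adjacentˢ (signature i j (suc k) l (toℕ u)) (signature i j (suc k) l (toℕ v))
adjR≡adjacentˢ i j k l u v = guard-redundant (edgeR i j (suc k) l) (edgeR-irrefl i j k l) (toℕ u) (toℕ v)

nonTriangle : (lx ly p w lw : Bool) → Signature
nonTriangle lx ly p w lw = record
  { isX = false ; isY = false ; isZ = false
  ; inLeavesX = lx ; inLeavesY = ly ; inPendants = p ; isW = w ; inLeavesW = lw }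

Xˢ Yˢ Zˢ leafXˢ leafYˢ wˢ pendantˢ leafWˢ : Signature
Xˢ = record (nonTriangle false false false false false) { isX = true }
Yˢ = record (nonTriangle false false false false false) { isY = true }
Zˢ = record (nonTriangle false false false false false) { isZ = true }
leafXˢ   = nonTriangle true  false false false false
leafYˢ   = nonTriangle false true  false false false
wˢ       = nonTriangle false false true  true  false
pendantˢ = nonTriangle false false true  false false
leafWˢ   = nonTriangle false false false false true

module VertexTypes (i j k l : ℕ) where

  σ : ℕ → Signature
  σ = signature i j (suc k) l

  σ-leafX : ∀ {x} → x < i → σ (3 + x) ≡ leafXˢ
  σ-leafX x<i = congₙ 5 nonTriangle
    (inR-true 0 i z≤n x<i) (inR-below (i + j) x<i) (inR-below (i + j + suc k) x<i+j)
    (≡ᵇ-false (<⇒≢ x<i+j)) (inR-below (i + j + suc k + l) (m≤n⇒m≤n+o (suc k) x<i+j))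
    where x<i+j = m≤n⇒m≤n+o j x<i

  σ-leafY : ∀ {x} → i ≤ x → x < i + j → σ (3 + x) ≡ leafYˢ
  σ-leafY i≤x x<i+j = congₙ 5 nonTriangle
    (inR-above 0 i≤x) (inR-true i (i + j) i≤x x<i+j) (inR-below (i + j + suc k) x<i+j)
    (≡ᵇ-false (<⇒≢ x<i+j)) (inR-below (i + j + suc k + l) (m≤n⇒m≤n+o (suc k) x<i+j))

  σ-w : ∀ {x} → x ≡ i + j → σ (3 + x) ≡ wˢ
  σ-w refl = congₙ 5 nonTriangle
    (inR-above 0 (m≤m+n i j)) (inR-above i ≤-refl)
    (inR-true (i + j) (i + j + suc k) ≤-refl (m<m+n (i + j) z<s))
    (≡ᵇ-refl (i + j)) (inR-below (i + j + suc k + l) (m<m+n (i + j) z<s))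

  σ-pendant : ∀ {x} → i + j < x → x < i + j + suc k → σ (3 + x) ≡ pendantˢ
  σ-pendant w<x x<c = congₙ 5 nonTriangle
    (inR-above 0 (≤-trans (m≤m+n i j) (<⇒≤ w<x))) (inR-above i (<⇒≤ w<x))
    (inR-true (i + j) (i + j + suc k) (<⇒≤ w<x) x<c)
    (≡ᵇ-false (>⇒≢ w<x)) (inR-below (i + j + suc k + l) x<c)

  σ-leafW : ∀ {x} → i + j + suc k ≤ x → x < i + j + suc k + l → σ (3 + x) ≡ leafWˢ
  σ-leafW c≤x x<d = congₙ 5 nonTriangle
    (inR-above 0 (≤-trans (m≤m+n i j) w≤x)) (inR-above i w≤x) (inR-above (i + j) c≤x)
    (≡ᵇ-false (>⇒≢ w<x)) (inR-true (i + j + suc k) (i + j + suc k + l) c≤x x<d)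
    where
    w<x = <-≤-trans (m<m+n (i + j) z<s) c≤x
    w≤x = <⇒≤ w<x

  sum-applyUpTo-σ : ∀ (h : Signature → ℕ) →
    sum (applyUpTo (h ∘ σ) (i + j + suc k + l + 3))
      ≡ h Xˢ + (h Yˢ + (h Zˢ + (i * h leafXˢ + j * h leafYˢ + (h wˢ + k * h pendantˢ) + l * h leafWˢ)))
  sum-applyUpTo-σ h =
    trans (cong (sum ∘ applyUpTo (h ∘ σ)) (+-comm (i + j + suc k + l) 3))
          (cong (λ s → h Xˢ + (h Yˢ + (h Zˢ + s))) blocks)
    where
    g : ℕ → ℕ
    g x = h (σ (3 + x))
    leavesX = sum-applyUpTo-const g i (λ x x<i → cong h (σ-leafX x<i))
    leavesY = sum-applyUpTo-const _ j (λ y y<j → cong h (σ-leafY (m≤m+n i y) (+-monoʳ-< i y<j)))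
    pendants = sum-applyUpTo-const _ k (λ z z<k →
      cong h (σ-pendant (m<m+n (i + j) z<s) (+-monoʳ-< (i + j) (s<s z<k))))
    leavesW = sum-applyUpTo-const _ l (λ z z<l →
      cong h (σ-leafW (m≤m+n (i + j + suc k) z) (+-monoʳ-< (i + j + suc k) z<l)))
    blocks : sum (applyUpTo g (i + j + suc k + l))
             ≡ i * h leafXˢ + j * h leafYˢ + (h wˢ + k * h pendantˢ) + l * h leafWˢ
    blocks =
      trans (sum-applyUpTo-++ g (i + j + suc k) l) (cong₂ _+_
        (trans (sum-applyUpTo-++ g (i + j) (suc k)) (cong₂ _+_
          (trans (sum-applyUpTo-++ g i j) (cong₂ _+_ leavesX leavesY))
          (cong₂ _+_ (cong h (σ-w (+-identityʳ (i + j)))) pendants)))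
        leavesW)

  types : List Signature
  types = map (σ ∘ toℕ) (vertices (i + j + suc k + l + 3))

  sum-map-types : ∀ (h : Signature → ℕ) →
    sum (map h types)
      ≡ h Xˢ + (h Yˢ + (h Zˢ + (i * h leafXˢ + j * h leafYˢ + (h wˢ + k * h pendantˢ) + l * h leafWˢ)))
  sum-map-types h = begin
    sum (map h types)                          ≡⟨ cong (sum ∘ map h) (map-tabulate {n = N} id (σ ∘ toℕ)) ⟩
    sum (map h (tabulate {n = N} (σ ∘ toℕ)))   ≡⟨ cong (sum ∘ map h) (tabulate-toℕ N σ) ⟩
    sum (map h (applyUpTo σ N))                ≡⟨ cong sum (map-applyUpTo σ h N) ⟩
    sum (applyUpTo (h ∘ σ) N)                  ≡⟨ sum-applyUpTo-σ h ⟩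
    _                                          ∎
    where
    open ≡-Reasoning
    N = i + j + suc k + l + 3

  degreeˢ : Signature → ℕ
  degreeˢ s = sum (map (𝟙 ∘ adjacentˢ s) types)

  -- The solver evaluates the closed coefficients 𝟙 (adjacentˢ s t).
  degree-X : degreeˢ Xˢ ≡ 2 + i
  degree-X = trans (sum-map-types _) (solve (i ∷ j ∷ k ∷ l ∷ []))
  degree-Y : degreeˢ Yˢ ≡ 2 + j
  degree-Y = trans (sum-map-types _) (solve (i ∷ j ∷ k ∷ l ∷ []))
  degree-Z : degreeˢ Zˢ ≡ 3 + k
  degree-Z = trans (sum-map-types _) (solve (i ∷ j ∷ k ∷ l ∷ []))
  degree-leafX : degreeˢ leafXˢ ≡ 1
  degree-leafX = trans (sum-map-types _) (solve (i ∷ j ∷ k ∷ l ∷ []))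
  degree-leafY : degreeˢ leafYˢ ≡ 1
  degree-leafY = trans (sum-map-types _) (solve (i ∷ j ∷ k ∷ l ∷ []))
  degree-w : degreeˢ wˢ ≡ 1 + l
  degree-w = trans (sum-map-types _) (solve (i ∷ j ∷ k ∷ l ∷ []))
  degree-pendant : degreeˢ pendantˢ ≡ 1
  degree-pendant = trans (sum-map-types _) (solve (i ∷ j ∷ k ∷ l ∷ []))
  degree-leafW : degreeˢ leafWˢ ≡ 1
  degree-leafW = trans (sum-map-types _) (solve (i ∷ j ∷ k ∷ l ∷ []))

Findex-R : ∀ i j k l →
  Findex (R i j (suc k) l) ≡ (2 + i) ^ 3 + (2 + j) ^ 3 + (3 + k) ^ 3 + (1 + l) ^ 3 + (i + j + k + l)
Findex-R i j k l = begin
  Findex (R i j (suc k) l)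
    ≡⟨ Findex-by-types (R i j (suc k) l) (σ ∘ toℕ) adjacentˢ (adjR≡adjacentˢ i j k l) ⟩
  sum (map (λ s → degreeˢ s ^ 3) types)
    ≡⟨ sum-map-types (λ s → degreeˢ s ^ 3) ⟩
  degreeˢ Xˢ ^ 3 + (degreeˢ Yˢ ^ 3 + (degreeˢ Zˢ ^ 3 + (i * degreeˢ leafXˢ ^ 3 + j * degreeˢ leafYˢ ^ 3
    + (degreeˢ wˢ ^ 3 + k * degreeˢ pendantˢ ^ 3) + l * degreeˢ leafWˢ ^ 3)))
    ≡⟨ congₙ 8 (λ dX dY dZ dLX dLY dW dP dLW → dX ^ 3 + (dY ^ 3 + (dZ ^ 3 + (i * dLX ^ 3 + j * dLY ^ 3
         + (dW ^ 3 + k * dP ^ 3) + l * dLW ^ 3))))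
         degree-X degree-Y degree-Z degree-leafX degree-leafY degree-w degree-pendant degree-leafW ⟩
  (2 + i) ^ 3 + ((2 + j) ^ 3 + ((3 + k) ^ 3 + (i * 1 ^ 3 + j * 1 ^ 3
    + ((1 + l) ^ 3 + k * 1 ^ 3) + l * 1 ^ 3)))
    ≡⟨ collect ((2 + i) ^ 3) ((2 + j) ^ 3) ((3 + k) ^ 3) ((1 + l) ^ 3) ⟩
  (2 + i) ^ 3 + (2 + j) ^ 3 + (3 + k) ^ 3 + (1 + l) ^ 3 + (i + j + k + l) ∎
  where
  open VertexTypes i j k l
  open ≡-Reasoning
  -- The cubes are abstracted because the reflective solver does not recognise ℕ's _^_.
  collect : ∀ cX cY cZ cW → cX + (cY + (cZ + (i * 1 ^ 3 + j * 1 ^ 3 + (cW + k * 1 ^ 3) + l * 1 ^ 3)))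
                            ≡ cX + cY + cZ + cW + (i + j + k + l)
  collect cX cY cZ cW = solve (cX ∷ cY ∷ cZ ∷ cW ∷ i ∷ j ∷ k ∷ l ∷ [])

triangle-cubes-gap : ∀ a b → 2 ^ 3 + 2 ^ 3 + (3 + (a + suc b)) ^ 3
  ≡ (3 + a) ^ 3 + 2 ^ 3 + (3 + b) ^ 3 + (18 + 3 * (7 * (a + b) + a * a + b * b + 8 * a * b + a * b * (a + b)))
triangle-cubes-gap = +-*-Solver.solve 2 (λ a b →
    con 2 :^ 3 :+ con 2 :^ 3 :+ (con 3 :+ (a :+ (con 1 :+ b))) :^ 3
  := (con 3 :+ a) :^ 3 :+ con 2 :^ 3 :+ (con 3 :+ b) :^ 3
     :+ (con 18 :+ con 3 :* (con 7 :* (a :+ b) :+ a :* a :+ b :* b :+ con 8 :* a :* b :+ a :* b :* (a :+ b)))) refl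
  where open +-*-Solver using (con; _:+_; _:*_; _:^_; _:=_)

triangle-cubes : ∀ a b →
  (3 + a) ^ 3 + 2 ^ 3 + (3 + b) ^ 3 < 2 ^ 3 + 2 ^ 3 + (3 + (a + suc b)) ^ 3
triangle-cubes a b = <-≤-trans (m<m+n _ z<s) (≤-reflexive (sym (triangle-cubes-gap a b)))

theorem7 : (i k l : ℕ) → i ≥ 1 → k ≥ 1 → l ≥ 1 →
    Findex (R i 0 k l) < Findex (R 0 0 (i + k) l)
theorem7 (suc p) (suc k) l _ _ _ = begin-strict
  Findex (R (suc p) 0 (suc k) l)
    ≡⟨ Findex-R (suc p) 0 k l ⟩
  (3 + p) ^ 3 + 2 ^ 3 + (3 + k) ^ 3 + (1 + l) ^ 3 + (suc p + 0 + k + l)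
    <⟨ +-mono-<-≤ (+-monoˡ-< ((1 + l) ^ 3) (triangle-cubes p k)) (≤-reflexive same-leaves) ⟩
  2 ^ 3 + 2 ^ 3 + (3 + (p + suc k)) ^ 3 + (1 + l) ^ 3 + (0 + 0 + (p + suc k) + l)
    ≡⟨ Findex-R 0 0 (p + suc k) l ⟨
  Findex (R 0 0 (suc p + suc k) l) ∎
  where
  open ≤-Reasoning
  same-leaves : suc p + 0 + k + l ≡ 0 + 0 + (p + suc k) + l
  same-leaves = solve (p ∷ k ∷ l ∷ [])
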